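{- There exists a graph $G$ such that the clique relaxation $R_{\mathrm{clique}}(G) = \{x \in R_{\mathrm{edge}}(G) : \sum_{v \in V(C)} x_v \le 1 \text{ for each clique } C \text{ of } G\}$ does not have the persistency property.
   Context: For a finite simple graph $G$, $R_{\mathrm{edge}}(G) = \{x \in [0,1]^{V(G)} : x_v + x_w \le 1 \text{ for each edge } \{v,w\} \in E(G)\}$. A polytope $P \subseteq [0,1]^n$ has the persistency property if for every $c \in \mathbb{R}^n$ and every point $x \in P$ maximizing $c^\top x$ over $P$, there exists $y \in P \cap \{0,1\}^n$ maximizing $c^\top y$ over $P \cap \{0,1\}^n$ such that $y_i = x_i$ for every $i$ with $x_i \in \{0,1\}$.
   Formalization: In the persistency property, the objective vectors c and the points of the polytope, including those compared in each maximization, are taken in ℚ^n instead of ℝ^n. -}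

module Defs where

open import Data.Nat using (ℕ; zero; suc)
open import Data.Fin using (Fin; zero; suc)
open import Data.Bool using (Bool; true; false; if_then_else_)
open import Data.Rational using (ℚ; 0ℚ; 1ℚ; _+_; _*_; _≤_)
open import Data.Product using (Σ; _×_; ∃)
open import Data.Sum using (_⊎_)
open import Relation.Binary.PropositionalEquality using (_≡_; _≢_)

record Graph (n : ℕ) : Set where
  field
    adj     : Fin n → Fin n → Bool
    adj-sym : ∀ u v → adj u v ≡ adj v u
    adj-irr : ∀ v → adj v v ≡ false
open Graph public

Point : ℕ → Set
Point n = Fin n → ℚ

Region : ℕ → Set₁
Region n = Point n → Set

sumFin : ∀ {n} → (Fin n → ℚ) → ℚ
sumFin {zero}  f = 0ℚ
sumFin {suc n} f = f zero + sumFin (λ i → f (suc i))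

_·_ : ∀ {n} → Point n → Point n → ℚ
c · x = sumFin (λ i → c i * x i)

IsClique : ∀ {n} → Graph n → (Fin n → Bool) → Set
IsClique G C = ∀ u v → C u ≡ true → C v ≡ true → u ≢ v → adj G u v ≡ true

InUnitCube : ∀ {n} → Point n → Set
InUnitCube x = ∀ i → (0ℚ ≤ x i) × (x i ≤ 1ℚ)

Redge : ∀ {n} → Graph n → Region n
Redge G x = InUnitCube x × (∀ v w → adj G v w ≡ true → x v + x w ≤ 1ℚ)

Rclique : ∀ {n} → Graph n → Region n
Rclique {n} G x = Redge G x
  × (∀ (C : Fin n → Bool) → IsClique G C
       → sumFin (λ v → if C v then x v else 0ℚ) ≤ 1ℚ)

IsBinary : ∀ {n} → Point n → Set
IsBinary x = ∀ i → (x i ≡ 0ℚ) ⊎ (x i ≡ 1ℚ)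

Maximizes : ∀ {n} → Region n → Point n → Point n → Set
Maximizes P c x = P x × (∀ z → P z → (c · z) ≤ (c · x))

IntegerPart : ∀ {n} → Region n → Region n
IntegerPart P x = P x × IsBinary x

Persistency : ∀ {n} → Region n → Set
Persistency {n} P =
  ∀ (c x : Point n) → Maximizes P c x →
    ∃ λ (y : Point n) → Maximizes (IntegerPart P) c y
      × (∀ i → (x i ≡ 0ℚ) ⊎ (x i ≡ 1ℚ) → y i ≡ x i)

module Submission where

-- The 5-wheel W₅ (a hub joined to every vertex of a 5-cycle) is a graph whose clique
-- relaxation lacks the persistency property.  Take weights c = 9 on the hub and 4 on
-- the rim.  The fractional point x = (0; ½,…,½) has value 10 and is optimal over
-- R_clique(W₅): c is dominated by twice the sum of the indicators of the five hub
-- triangles, so weak LP duality bounds every feasible value by 2·5 = 10.  Persistency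
-- would demand an integral optimum with hub coordinate 0; but such a point is a stable
-- set of the 5-cycle, worth at most 4·2 = 8, while the hub alone is worth 9.

open import Defs
open import Data.Nat using (ℕ; zero; suc)
open import Data.Fin using (Fin; zero; suc)
open import Data.Fin.Properties using (all?) renaming (_≟_ to _≟ᶠ_)
open import Data.Bool using (Bool; true; false; if_then_else_; _∨_)
open import Data.Bool.Properties using (∨-comm) renaming (_≟_ to _≟ᵇ_)
open import Data.Rational
  using (ℚ; 0ℚ; 1ℚ; ½; normalize; _+_; _*_; _≤_; _<_; _≤?_; _<?_; nonNegative) renaming (_≟_ to _≟ᵠ_)
open import Data.Rational.Properties
  using ( ≤-refl; ≤-reflexive; ≤-trans; <-irrefl; <-≤-trans; +-mono-≤; +-identityʳ
        ; *-assoc; *-identityˡ; *-zeroˡ; *-zeroʳ; *-distribˡ-+; *-distribʳ-+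
        ; *-monoʳ-≤-nonNeg; *-monoˡ-≤-nonNeg; +-0-commutativeMonoid; module ≤-Reasoning )
open import Algebra.Bundles using (CommutativeMonoid)
open import Algebra.Properties.CommutativeSemigroup
  (CommutativeMonoid.commutativeSemigroup +-0-commutativeMonoid) using (interchange)
open import Data.Product using (Σ; _,_; proj₁; proj₂)
open import Data.Sum using (_⊎_; inj₁; inj₂)
open import Data.Vec.Functional using (_∷_)
open import Function using (_∘_)
open import Relation.Nullary using (¬_; Dec; does)
open import Relation.Nullary.Decidable using (map′; _×-dec_; _→-dec_; ¬?; dec-false; from-yes)
open import Relation.Binary.PropositionalEquality
  using (_≡_; _≢_; refl; sym; trans; cong; cong₂; subst)

-- Finite sums.  Defs.sumFin is not definitionally the library's Vector sum, so the few
-- identities weak duality needs are proved directly by induction on the length.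

sumFin-cong : ∀ {n} {f g : Fin n → ℚ} → (∀ i → f i ≡ g i) → sumFin f ≡ sumFin g
sumFin-cong {zero}  f≗g = refl
sumFin-cong {suc n} f≗g = cong₂ _+_ (f≗g zero) (sumFin-cong (f≗g ∘ suc))

sumFin-mono : ∀ {n} {f g : Fin n → ℚ} → (∀ i → f i ≤ g i) → sumFin f ≤ sumFin g
sumFin-mono {zero}  f≤g = ≤-refl
sumFin-mono {suc n} f≤g = +-mono-≤ (f≤g zero) (sumFin-mono (f≤g ∘ suc))

sumFin-zero : ∀ n → sumFin {n} (λ _ → 0ℚ) ≡ 0ℚ
sumFin-zero zero    = refl
sumFin-zero (suc n) = trans (cong (0ℚ +_) (sumFin-zero n)) (+-identityʳ 0ℚ)

sumFin-+ : ∀ {n} (f g : Fin n → ℚ) → sumFin (λ i → f i + g i) ≡ sumFin f + sumFin g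
sumFin-+ {zero}  f g = sym (+-identityʳ 0ℚ)
sumFin-+ {suc n} f g =
  trans (cong (f zero + g zero +_) (sumFin-+ (f ∘ suc) (g ∘ suc)))
        (interchange (f zero) (g zero) (sumFin (f ∘ suc)) (sumFin (g ∘ suc)))

sumFin-swap : ∀ {m n} (f : Fin m → Fin n → ℚ) →
  sumFin (λ i → sumFin (f i)) ≡ sumFin (λ j → sumFin (λ i → f i j))
sumFin-swap {zero}  {n} f = sym (sumFin-zero n)
sumFin-swap {suc m} f =
  trans (cong (sumFin (f zero) +_) (sumFin-swap (f ∘ suc)))
        (sym (sumFin-+ (f zero) (λ j → sumFin (λ i → f (suc i) j))))

*-distribˡ-sumFin : ∀ {n} k (f : Fin n → ℚ) → k * sumFin f ≡ sumFin (λ i → k * f i)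
*-distribˡ-sumFin {zero}  k f = *-zeroʳ k
*-distribˡ-sumFin {suc n} k f =
  trans (*-distribˡ-+ k (f zero) (sumFin (f ∘ suc)))
        (cong (k * f zero +_) (*-distribˡ-sumFin k (f ∘ suc)))

*-distribʳ-sumFin : ∀ {n} k (f : Fin n → ℚ) → sumFin f * k ≡ sumFin (λ i → f i * k)
*-distribʳ-sumFin {zero}  k f = *-zeroˡ k
*-distribʳ-sumFin {suc n} k f =
  trans (*-distribʳ-+ k (f zero) (sumFin (f ∘ suc)))
        (cong (f zero * k +_) (*-distribʳ-sumFin k (f ∘ suc)))

NonNegativePoint : ∀ {n} → Point n → Set
NonNegativePoint z = ∀ i → 0ℚ ≤ z i

weak-duality : ∀ {m n} (A : Fin m → Point n) (y b : Fin m → ℚ) (c z : Point n) →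
  NonNegativePoint y → NonNegativePoint z →
  (∀ i → c i ≤ sumFin (λ j → y j * A j i)) → (∀ j → A j · z ≤ b j) →
  c · z ≤ sumFin (λ j → y j * b j)
weak-duality A y b c z y≥0 z≥0 c≤yA Az≤b = begin
  c · z                                            ≤⟨ sumFin-mono c·z≤yA·z ⟩
  sumFin (λ i → sumFin (λ j → y j * A j i) * z i)  ≡⟨ sumFin-cong (λ i → *-distribʳ-sumFin (z i) (λ j → y j * A j i)) ⟩
  sumFin (λ i → sumFin (λ j → y j * A j i * z i))  ≡⟨ sumFin-swap (λ i j → y j * A j i * z i) ⟩
  sumFin (λ j → sumFin (λ i → y j * A j i * z i))  ≡⟨ sumFin-cong (λ j → sym (pull-out j)) ⟩
  sumFin (λ j → y j * (A j · z))                    ≤⟨ sumFin-mono y·Az≤y·b ⟩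
  sumFin (λ j → y j * b j)                          ∎
  where
  open ≤-Reasoning
  c·z≤yA·z : ∀ i → c i * z i ≤ sumFin (λ j → y j * A j i) * z i
  c·z≤yA·z i = *-monoʳ-≤-nonNeg (z i) {{nonNegative (z≥0 i)}} (c≤yA i)
  pull-out : ∀ j → y j * (A j · z) ≡ sumFin (λ i → y j * A j i * z i)
  pull-out j = trans (*-distribˡ-sumFin (y j) (λ i → A j i * z i))
                     (sumFin-cong (λ i → sym (*-assoc (y j) (A j i) (z i))))
  y·Az≤y·b : ∀ j → y j * (A j · z) ≤ y j * b j
  y·Az≤y·b j = *-monoˡ-≤-nonNeg (y j) {{nonNegative (y≥0 j)}} (Az≤b j)

AgreesOnIntegral : ∀ {n} → Point n → Point n → Set
AgreesOnIntegral x y = ∀ i → (x i ≡ 0ℚ) ⊎ (x i ≡ 1ℚ) → y i ≡ x i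

not-persistent : ∀ {n} (P : Region n) (c x z : Point n) →
  Maximizes P c x → IntegerPart P z →
  (∀ y → IntegerPart P y → AgreesOnIntegral x y → c · y < c · z) →
  ¬ Persistency P
not-persistent P c x z x-optimal z∈P beaten persistent
  with persistent c x x-optimal
... | y , (y∈P , y-optimal) , agrees =
  <-irrefl refl (<-≤-trans (beaten y y∈P agrees) (y-optimal z z∈P))

Respects≗ : ∀ {A : Set} {n} → ((Fin n → A) → Set) → Set
Respects≗ P = ∀ {f g} → (∀ i → f i ≡ g i) → P f → P g

all-subsets? : ∀ {n} {P : (Fin n → Bool) → Set} →
  Respects≗ P → (∀ f → Dec (P f)) → Dec (∀ f → P f)
all-subsets? {zero} resp P? = map′ (λ P-empty f → resp (λ ()) P-empty) (λ ∀P → ∀P ∅) (P? ∅)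
  where
  ∅ : Fin 0 → Bool
  ∅ ()
all-subsets? {suc n} {P} resp P? =
  map′ (λ (P-true , P-false) f → resp (head∷tail f) (choose (f zero) P-true P-false (f ∘ suc)))
       (λ ∀P → (λ g → ∀P (true ∷ g)) , (λ g → ∀P (false ∷ g)))
       (extend true ×-dec extend false)
  where
  cons-cong : ∀ b {f g : Fin n → Bool} → (∀ i → f i ≡ g i) → ∀ i → (b ∷ f) i ≡ (b ∷ g) i
  cons-cong b eq zero    = refl
  cons-cong b eq (suc i) = eq i
  extend : ∀ b → Dec (∀ g → P (b ∷ g))
  extend b = all-subsets? (resp ∘ cons-cong b) (λ g → P? (b ∷ g))
  choose : ∀ b → (∀ g → P (true ∷ g)) → (∀ g → P (false ∷ g)) → ∀ g → P (b ∷ g)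
  choose true  P-true P-false = P-true
  choose false P-true P-false = P-false
  head∷tail : ∀ (f : Fin (suc n) → Bool) i → (f zero ∷ f ∘ suc) i ≡ f i
  head∷tail f zero    = refl
  head∷tail f (suc i) = refl

Redge-resp : ∀ {n} (G : Graph n) → Respects≗ (Redge G)
Redge-resp G y≗z (cube , edges) =
  (λ i → subst (0ℚ ≤_) (y≗z i) (proj₁ (cube i)) , subst (_≤ 1ℚ) (y≗z i) (proj₂ (cube i))) ,
  (λ v w vw → subst (_≤ 1ℚ) (cong₂ _+_ (y≗z v) (y≗z w)) (edges v w vw))

Redge? : ∀ {n} (G : Graph n) z → Dec (Redge G z)
Redge? G z =
  all? (λ i → (0ℚ ≤? z i) ×-dec (z i ≤? 1ℚ)) ×-dec
  all? (λ v → all? (λ w → (adj G v w ≟ᵇ true) →-dec (z v + z w ≤? 1ℚ)))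

IsClique? : ∀ {n} (G : Graph n) C → Dec (IsClique G C)
IsClique? G C =
  all? (λ u → all? (λ v →
    (C u ≟ᵇ true) →-dec (C v ≟ᵇ true) →-dec ¬? (u ≟ᶠ v) →-dec (adj G u v ≟ᵇ true)))

CliqueConstraint : ∀ {n} → Graph n → Point n → (Fin n → Bool) → Set
CliqueConstraint G z C = IsClique G C → sumFin (λ v → if C v then z v else 0ℚ) ≤ 1ℚ

CliqueConstraint-resp : ∀ {n} (G : Graph n) z → Respects≗ (CliqueConstraint G z)
CliqueConstraint-resp G z C≗D constraint D-clique =
  subst (_≤ 1ℚ) (sumFin-cong (λ v → cong (λ b → if b then z v else 0ℚ) (C≗D v)))
        (constraint (λ u v Cu Cv → D-clique u v (trans (sym (C≗D u)) Cu) (trans (sym (C≗D v)) Cv)))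

Rclique? : ∀ {n} (G : Graph n) z → Dec (Rclique G z)
Rclique? G z =
  Redge? G z ×-dec
  all-subsets? (CliqueConstraint-resp G z)
               (λ C → IsClique? G C →-dec (sumFin (λ v → if C v then z v else 0ℚ) ≤? 1ℚ))

indicator : ∀ {n} → (Fin n → Bool) → Point n
indicator C v = if C v then 1ℚ else 0ℚ

-- The clique constraints in dot-product form, the shape weak duality consumes.
clique-inequality : ∀ {n} (G : Graph n) {z C} → Rclique G z → IsClique G C → indicator C · z ≤ 1ℚ
clique-inequality G {z} {C} (_ , constraints) C-clique =
  subst (_≤ 1ℚ) (sumFin-cong select) (constraints C C-clique)
  where
  select : ∀ v → (if C v then z v else 0ℚ) ≡ indicator C v * z v
  select v with C v
  ... | true  = sym (*-identityˡ (z v))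
  ... | false = sym (*-zeroˡ (z v))

bit : Bool → ℚ
bit true  = 1ℚ
bit false = 0ℚ

bit-of : ∀ {q} → (q ≡ 0ℚ) ⊎ (q ≡ 1ℚ) → Σ Bool λ b → bit b ≡ q
bit-of (inj₁ q≡0) = false , sym q≡0
bit-of (inj₂ q≡1) = true , sym q≡1

all-binary : ∀ {n} {P : Point n → Set} → Respects≗ P →
  (∀ b → P (bit ∘ b)) → ∀ y → IsBinary y → P y
all-binary resp P-bits y binary =
  resp (λ i → proj₂ (bit-of (binary i))) (P-bits (λ i → proj₁ (bit-of (binary i))))

successorGraph : ∀ {n} (next : Fin n → Fin n) → (∀ i → next i ≢ i) → Graph n
successorGraph next no-fixpoint = record
  { adj     = λ i j → does (j ≟ᶠ next i) ∨ does (i ≟ᶠ next j)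
  ; adj-sym = λ i j → ∨-comm (does (j ≟ᶠ next i)) (does (i ≟ᶠ next j))
  ; adj-irr = λ i → let i≢next = dec-false (i ≟ᶠ next i) (no-fixpoint i ∘ sym)
                    in cong₂ _∨_ i≢next i≢next
  }

cone : ∀ {n} → Graph n → Graph (suc n)
cone G = record { adj = adjᶜ ; adj-sym = symᶜ ; adj-irr = irrᶜ }
  where
  adjᶜ : _ → _ → Bool
  adjᶜ zero    zero    = false
  adjᶜ zero    (suc _) = true
  adjᶜ (suc _) zero    = true
  adjᶜ (suc u) (suc v) = adj G u v
  symᶜ : ∀ u v → adjᶜ u v ≡ adjᶜ v u
  symᶜ zero    zero    = refl
  symᶜ zero    (suc _) = refl
  symᶜ (suc _) zero    = refl
  symᶜ (suc u) (suc v) = adj-sym G u v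
  irrᶜ : ∀ v → adjᶜ v v ≡ false
  irrᶜ zero    = refl
  irrᶜ (suc v) = adj-irr G v

rotate : Fin 5 → Fin 5
rotate zero                          = suc zero
rotate (suc zero)                    = suc (suc zero)
rotate (suc (suc zero))              = suc (suc (suc zero))
rotate (suc (suc (suc zero)))        = suc (suc (suc (suc zero)))
rotate (suc (suc (suc (suc zero))))  = zero

rotate-no-fixpoint : ∀ i → rotate i ≢ i
rotate-no-fixpoint zero                         ()
rotate-no-fixpoint (suc zero)                   ()
rotate-no-fixpoint (suc (suc zero))             ()
rotate-no-fixpoint (suc (suc (suc zero)))       ()
rotate-no-fixpoint (suc (suc (suc (suc zero)))) ()

-- W₅: vertex zero is the hub, vertex suc i is the i-th vertex of the rim C₅.
wheel : Graph 6
wheel = cone (successorGraph rotate rotate-no-fixpoint)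

-- The hub triangles {hub, rim j, rim (j+1)}: cliques whose indicators form the dual certificate.
triangle : Fin 5 → Fin 6 → Bool
triangle j zero    = true
triangle j (suc i) = does (i ≟ᶠ j) ∨ does (i ≟ᶠ rotate j)

triangle-clique : ∀ j → IsClique wheel (triangle j)
triangle-clique = from-yes (all? (IsClique? wheel ∘ triangle))

weight : Point 6
weight zero    = normalize 9 1
weight (suc _) = normalize 4 1

half-rim : Point 6
half-rim zero    = 0ℚ
half-rim (suc _) = ½

hub : Point 6
hub zero    = 1ℚ
hub (suc _) = 0ℚ

two : ℚ
two = normalize 2 1

weight-dominated : ∀ i → weight i ≤ sumFin (λ j → two * indicator (triangle j) i)
weight-dominated = from-yes (all? (λ i → weight i ≤? sumFin (λ j → two * indicator (triangle j) i)))

-- half-rim attains the dual bound 2 · 5 = 10 (both sides evaluate to 10), hence is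
-- optimal over R_clique(W₅); its feasibility is decided by exhaustive checking.
half-rim-optimal : Maximizes (Rclique wheel) weight half-rim
half-rim-optimal = from-yes (Rclique? wheel half-rim) , bounded
  where
  bounded : ∀ z → Rclique wheel z → weight · z ≤ weight · half-rim
  bounded z z∈R =
    ≤-trans (weak-duality (indicator ∘ triangle) (λ _ → two) (λ _ → 1ℚ) weight z
                          (λ _ → from-yes (0ℚ ≤? two)) z≥0
                          weight-dominated
                          (clique-inequality wheel z∈R ∘ triangle-clique))
            (≤-reflexive refl)
    where
    z≥0 : NonNegativePoint z
    z≥0 i = proj₁ (proj₁ (proj₁ z∈R) i)

hub-feasible : IntegerPart (Rclique wheel) hub
hub-feasible = from-yes (Rclique? wheel hub) , binary
  where
  binary : IsBinary hub
  binary zero    = inj₂ refl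
  binary (suc _) = inj₁ refl

-- A binary point of R_edge(W₅) avoiding the hub is a stable set of C₅, so it has at most
-- two rim vertices and value at most 8 < 9 = weight · hub.
HubFreeBeaten : Point 6 → Set
HubFreeBeaten y = Redge wheel y → y zero ≡ 0ℚ → weight · y < weight · hub

hub-free-beaten : ∀ y → IsBinary y → HubFreeBeaten y
hub-free-beaten = all-binary resp (from-yes (all-subsets? (resp ∘ bits-cong) decide))
  where
  resp : Respects≗ HubFreeBeaten
  resp y≗z beaten z∈R z₀≡0 =
    subst (_< weight · hub) (sumFin-cong (λ i → cong (weight i *_) (y≗z i)))
          (beaten (Redge-resp wheel (sym ∘ y≗z) z∈R) (trans (y≗z zero) z₀≡0))
  bits-cong : ∀ {b b′ : Fin 6 → Bool} → (∀ i → b i ≡ b′ i) → ∀ i → bit (b i) ≡ bit (b′ i)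
  bits-cong b≗b′ i = cong bit (b≗b′ i)
  decide : ∀ b → Dec (HubFreeBeaten (bit ∘ b))
  decide b = Redge? wheel (bit ∘ b) →-dec (bit (b zero) ≟ᵠ 0ℚ) →-dec (weight · (bit ∘ b) <? weight · hub)

corollary1 : Σ ℕ λ n → Σ (Graph n) λ G → ¬ Persistency (Rclique G)
corollary1 =
  6 , wheel ,
  not-persistent (Rclique wheel) weight half-rim hub half-rim-optimal hub-feasible
    (λ y (y∈R , binary) agrees → hub-free-beaten y binary (proj₁ y∈R) (agrees zero (inj₁ refl)))
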